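{- Let $\sigma\le\tau$ in the consecutive pattern poset $S$, let $n=|\tau|-|\sigma|$, and let $C:\tau=\rho_0\to\rho_1\to\cdots\to\rho_n=\sigma$ be a maximal chain of $[\sigma,\tau]$ with chain id $l_1\ldots l_n$. Suppose there are indices $0\le i<j\le n$ such that $\rho_j=x(\rho_i)$, $x(\rho_i)\not\le i(\rho_i)$, and the sequence $l_{i+1},\ldots,l_j$ is decreasing (where a sequence consisting of a single label is not considered decreasing). Then $C(\rho_i,\rho_j)$ is a minimal skipped interval of $C$, with respect to the lexicographic order of chain ids on the maximal chains of $[\sigma,\tau]$.
   Context: For $d\ge1$, $S_d$ is the set of permutations of $\{1,\dots,d\}$ in one-line notation, $S=\bigcup_{d>0}S_d$, and $|\tau|=d$ for $\tau\in S_d$. The standard form of a sequence of distinct integers $s(1)\ldots s(k)$ is the permutation in $S_k$ whose entries are in the same relative order. The consecutive pattern poset orders $S$ by $\sigma\le\tau$ ($\sigma\in S_k$, $\tau\in S_d$) iff for some $i$ the standard form of $\tau(i+1)\ldots\tau(i+k)$ equals $\sigma$. A permutation is monotone if its entries are strictly increasing or strictly decreasing. A prefix (resp. suffix) of length $k$ of $\rho\in S_d$ is the standard form of its first (resp. last) $k$ letters; it is proper if $k<d$. For $d>2$ the interior $i(\rho)$ is the standard form of $\rho(2)\ldots\rho(d-1)$. The exterior $x(\rho)$ is the longest permutation which is both a proper prefix and a suffix of $\rho$. In a maximal chain $\tau=\rho_0\to\cdots\to\rho_n=\sigma$ ($\to$ denotes a cover, $|\rho_i|=|\tau|-i$), the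 chain id $l_1\ldots l_n$ is defined inductively by windows of positions of $\tau$: $W_0=\{1,\dots,|\tau|\}$; given $W_{i-1}=\{a,\dots,b\}$ with the standard form of $\tau(a)\ldots\tau(b)$ equal to $\rho_{i-1}$: if $\rho_{i-1}$ is not monotone, exactly one of the standard forms of $\tau(a+1)\ldots\tau(b)$ and $\tau(a)\ldots\tau(b-1)$ equals $\rho_i$; in the first case put $l_i=a$, $W_i=\{a+1,\dots,b\}$, in the second $l_i=b$, $W_i=\{a,\dots,b-1\}$; if $\rho_{i-1}$ is monotone put $l_i=a$, $W_i=\{a+1,\dots,b\}$. Maximal chains of $[\sigma,\tau]$ are totally ordered by the lexicographic order of their chain ids. For $0\le i<j\le n$, $C(\rho_i,\rho_j)=\{\rho_{i+1},\dots,\rho_{j-1}\}$. A nonempty $C(\rho_i,\rho_j)$ is a skipped interval of $C$ if the set of elements of $C$ not in $C(\rho_i,\rho_j)$ is contained in some maximal chain $C'$ of $[\sigma,\tau]$ lexicographically earlier than $C$; it is a minimal skipped interval if it properly contains no other skipped interval of $C$. -}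

module Defs where

open import Data.Nat using (ℕ; zero; suc; _+_; _∸_; _≤_; _<_; _>_; _<?_)
open import Data.Nat.Properties using (<-cmp) renaming (_≟_ to _≟ℕ_)
open import Data.Fin using (Fin; toℕ; fromℕ; inject₁) renaming (zero to fz; suc to fs)
open import Data.List using (List; []; _∷_; length; take; drop; map; filter; upTo)
open import Data.List.Properties using (≡-dec)
open import Data.List.Relation.Unary.Linked using (Linked; linked?)
open import Data.List.Relation.Binary.Permutation.Propositional using (_↭_)
open import Data.List.Relation.Binary.Lex.Core using (Lex-<)
open import Data.Product using (Σ; ∃; ∃-syntax; _×_; _,_)
open import Data.Sum using (_⊎_; inj₁; inj₂)
open import Relation.Nullary using (¬_; Dec; yes; no)
open import Relation.Binary.PropositionalEquality using (_≡_; _≢_)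

-- Permutations in one-line notation are lists of naturals.

IsPerm : List ℕ → Set
IsPerm ρ = (0 < length ρ) × (ρ ↭ map suc (upTo (length ρ)))

-- standard form of a sequence of distinct integers:
-- each entry is replaced by its rank (1 + number of smaller entries).
std : List ℕ → List ℕ
std xs = map (λ x → suc (length (filter (_<? x) xs))) xs

-- consecutive pattern order: σ ≼ τ iff some factor τ(i+1)…τ(i+k) has standard form σ
_≼_ : List ℕ → List ℕ → Set
σ ≼ τ = ∃[ i ] (i + length σ ≤ length τ) × (std (take (length σ) (drop i τ)) ≡ σ)

_≺_ : List ℕ → List ℕ → Set
σ ≺ τ = (σ ≼ τ) × (σ ≢ τ)

_⋖_ : List ℕ → List ℕ → Set
σ ⋖ τ = (σ ≺ τ) × (∀ ρ → IsPerm ρ → ¬ ((σ ≺ ρ) × (ρ ≺ τ)))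

Monotone : List ℕ → Set
Monotone xs = Linked _<_ xs ⊎ Linked _>_ xs

monotone? : (xs : List ℕ) → Dec (Monotone xs)
monotone? xs with linked? _<?_ xs
... | yes p = yes (inj₁ p)
... | no ¬p with linked? (λ a b → b <? a) xs
...   | yes q = yes (inj₂ q)
...   | no ¬q = no λ { (inj₁ p) → ¬p p ; (inj₂ q) → ¬q q }

prefix : ℕ → List ℕ → List ℕ
prefix k ρ = std (take k ρ)

suffix : ℕ → List ℕ → List ℕ
suffix k ρ = std (drop (length ρ ∸ k) ρ)

interior : List ℕ → List ℕ
interior ρ = std (drop 1 (take (length ρ ∸ 1) ρ))

IsProperPrefixSuffix : List ℕ → List ℕ → Set
IsProperPrefixSuffix ρ e =
  (0 < length e) × (length e < length ρ) ×
  (prefix (length e) ρ ≡ e) × (suffix (length e) ρ ≡ e)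

IsExterior : List ℕ → List ℕ → Set
IsExterior ρ e = IsProperPrefixSuffix ρ e ×
  (∀ e' → IsProperPrefixSuffix ρ e' → length e' ≤ length e)

Chain : ℕ → Set
Chain n = Fin (suc n) → List ℕ

IsMaximalChain : {n : ℕ} → List ℕ → List ℕ → Chain n → Set
IsMaximalChain {n} σ τ ρ =
  (ρ fz ≡ τ) × (ρ (fromℕ n) ≡ σ) × (∀ (k : Fin n) → ρ (fs k) ⋖ ρ (inject₁ k))

-- window τ(a)…τ(b) (positions 1-indexed)
window : List ℕ → ℕ → ℕ → List ℕ
window τ a b = take (suc b ∸ a) (drop (a ∸ 1) τ)

labels : {n : ℕ} → List ℕ → ℕ → ℕ → Chain n → List ℕ
labels {zero} τ a b ρ = []
labels {suc n} τ a b ρ with monotone? (ρ fz)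
... | yes _ = a ∷ labels τ (suc a) b (λ k → ρ (fs k))
... | no _ with ≡-dec _≟ℕ_ (std (window τ (suc a) b)) (ρ (fs fz))
...   | yes _ = a ∷ labels τ (suc a) b (λ k → ρ (fs k))
...   | no _ = b ∷ labels τ a (b ∸ 1) (λ k → ρ (fs k))

chainId : {n : ℕ} → List ℕ → Chain n → List ℕ
chainId τ ρ = labels τ 1 (length τ) ρ

_<lex_ : List ℕ → List ℕ → Set
l <lex l' = Lex-< _≡_ _<_ l l'

InC : {n : ℕ} → Chain n → Fin (suc n) → Fin (suc n) → List ℕ → Set
InC ρ i j π = ∃[ k ] (toℕ i < toℕ k) × (toℕ k < toℕ j) × (ρ k ≡ π)

InChain : {n : ℕ} → Chain n → List ℕ → Set
InChain ρ π = ∃[ k ] ρ k ≡ π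

IsSkipped : {n : ℕ} → List ℕ → List ℕ → Chain n → Fin (suc n) → Fin (suc n) → Set
IsSkipped {n} σ τ ρ i j =
  (∃[ π ] InC ρ i j π) ×
  (∃[ ρ' ] (IsMaximalChain {n} σ τ ρ' × (chainId τ ρ' <lex chainId τ ρ) ×
     (∀ (k : Fin (suc n)) → ¬ InC ρ i j (ρ k) → InChain ρ' (ρ k))))

IsMinimalSkipped : {n : ℕ} → List ℕ → List ℕ → Chain n → Fin (suc n) → Fin (suc n) → Set
IsMinimalSkipped {n} σ τ ρ i j =
  IsSkipped σ τ ρ i j ×
  (∀ (i' j' : Fin (suc n)) → toℕ i' < toℕ j' → IsSkipped σ τ ρ i' j' →
     ¬ ((∀ π → InC ρ i' j' π → InC ρ i j π) × (∃[ π ] InC ρ i j π × ¬ InC ρ i' j' π)))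

DecreasingSegment : List ℕ → ℕ → ℕ → Set
DecreasingSegment l i j = (2 ≤ j ∸ i) × Linked _>_ (take (j ∸ i) (drop i l))

module Submission where

-- Along a maximal chain τ = ρ_0 → … → ρ_n every ρ_k occurs in τ as a factor at some
-- offset A_k, and the window of the chain-id algorithm is exactly that factor's span
-- {A_k+1, …, A_k+|ρ_k|}. Each cover deletes the first letter of the factor (label A_k+1,
-- A_{k+1} = A_k+1) or its last letter (label A_k+|ρ_k|, A_{k+1} = A_k); a first-letter label
-- is always the smaller one. Decreasing labels from i to j force last-letter deletions, so
-- ρ_i, …, ρ_{j-1} all sit at the same offset A. Deleting first letters of ρ_i instead gives an
-- earlier chain through the tails of ρ_i ending at its suffix x(ρ_i) = ρ_j: the interval is
-- skipped. For minimality, an earlier chain skipping a smaller interval first differs from ρ by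
-- a first-letter deletion, after which its occurrence of ρ_j' starts after A and ends no later
-- than ρ_i's; ending strictly earlier puts ρ_j inside the interior of ρ_i, ending together
-- makes ρ_j' a prefix and suffix of ρ_i longer than x(ρ_i).

open import Defs
open import Data.Nat
open import Data.Nat.Properties
open import Data.Fin using (Fin; toℕ; fromℕ; fromℕ<; inject₁) renaming (zero to fz; suc to fs)
open import Data.Fin.Properties using (toℕ-fromℕ<; toℕ-inject₁; toℕ<n; toℕ-fromℕ)
open import Data.List using (List; []; _∷_; length; take; drop; map; filter; upTo; applyUpTo)
open import Data.List.Properties
  using (filter-accept; filter-reject; take-map; drop-map; length-map; map-∘; map-id; map-applyUpTo; take-all; take-[]; drop-[]; length-take; length-drop; drop-drop; ≡-dec)
open import Data.List.Membership.Propositional using (_∈_)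
open import Data.List.Membership.Propositional.Properties using (∈-map⁻; ∈-upTo⁻)
open import Data.List.Relation.Unary.Any using (here; there)
open import Data.List.Relation.Unary.All as All using (All; []; _∷_)
open import Data.List.Relation.Unary.All.Properties using (take⁺; drop⁺)
open import Data.List.Relation.Unary.Linked as Linked using (Linked; []; [-]; _∷_)
open import Data.List.Relation.Unary.Linked.Properties using (Linked⇒All)
open import Data.List.Relation.Binary.Pointwise using (Pointwise; []; _∷_)
open import Data.List.Relation.Binary.Permutation.Propositional using (_↭_)
open import Data.List.Relation.Binary.Permutation.Propositional.Properties using (∈-resp-↭; ↭-length; filter-↭)
open import Data.List.Relation.Binary.Lex.Core using (Lex-<; this; next; base)
open import Data.Product using (Σ; ∃-syntax; _×_; _,_; proj₁; proj₂)
open import Data.Sum using (_⊎_; inj₁; inj₂)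
open import Data.Empty using (⊥; ⊥-elim)
open import Relation.Nullary using (¬_; Dec; yes; no)
open import Relation.Binary.PropositionalEquality hiding (J)
open import Relation.Binary.Definitions using (tri<; tri≈; tri>)

countBelow : ℕ → List ℕ → ℕ
countBelow u xs = length (filter (_<? u) xs)

rank : List ℕ → ℕ → ℕ
rank xs u = suc (countBelow u xs)

countBelow-∷< : ∀ {u y} ys → y < u → countBelow u (y ∷ ys) ≡ suc (countBelow u ys)
countBelow-∷< {u} ys y<u = cong length (filter-accept (_<? u) y<u)

countBelow-∷≮ : ∀ {u y} ys → ¬ y < u → countBelow u (y ∷ ys) ≡ countBelow u ys
countBelow-∷≮ {u} ys y≮u = cong length (filter-reject (_<? u) y≮u)

countBelow-mono-≤ : ∀ {u v} → u ≤ v → ∀ xs → countBelow u xs ≤ countBelow v xs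
countBelow-mono-≤ u≤v [] = z≤n
countBelow-mono-≤ {u} {v} u≤v (y ∷ ys) with y <? u | y <? v
... | yes p | yes q rewrite countBelow-∷< ys p | countBelow-∷< ys q = s≤s (countBelow-mono-≤ u≤v ys)
... | yes p | no ¬q = ⊥-elim (¬q (<-≤-trans p u≤v))
... | no ¬p | yes q rewrite countBelow-∷≮ ys ¬p | countBelow-∷< ys q = m≤n⇒m≤1+n (countBelow-mono-≤ u≤v ys)
... | no ¬p | no ¬q rewrite countBelow-∷≮ ys ¬p | countBelow-∷≮ ys ¬q = countBelow-mono-≤ u≤v ys

countBelow-mono-< : ∀ {u v} xs → u ∈ xs → u < v → countBelow u xs < countBelow v xs
countBelow-mono-< {u} {v} (y ∷ ys) (here refl) u<v
  rewrite countBelow-∷≮ {u} {u} ys (<-irrefl refl) | countBelow-∷< ys u<v =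
    s≤s (countBelow-mono-≤ (<⇒≤ u<v) ys)
countBelow-mono-< {u} {v} (y ∷ ys) (there u∈ys) u<v with y <? u | y <? v
... | yes p | yes q rewrite countBelow-∷< ys p | countBelow-∷< ys q = s≤s (countBelow-mono-< ys u∈ys u<v)
... | yes p | no ¬q = ⊥-elim (¬q (<-trans p u<v))
... | no ¬p | yes q rewrite countBelow-∷≮ ys ¬p | countBelow-∷< ys q = m≤n⇒m≤1+n (countBelow-mono-< ys u∈ys u<v)
... | no ¬p | no ¬q rewrite countBelow-∷≮ ys ¬p | countBelow-∷≮ ys ¬q = countBelow-mono-< ys u∈ys u<v

rank-mono-< : ∀ {u v} xs → u ∈ xs → u < v → rank xs u < rank xs v
rank-mono-< xs u∈xs u<v = s≤s (countBelow-mono-< xs u∈xs u<v)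

rank-reflects-< : ∀ {u v} xs → u ∈ xs → v ∈ xs → rank xs u < rank xs v → u < v
rank-reflects-< {u} {v} xs u∈xs v∈xs lt with <-cmp u v
... | tri< u<v _ _ = u<v
... | tri≈ _ refl _ = ⊥-elim (<-irrefl refl lt)
... | tri> _ _ v<u = ⊥-elim (<-asym lt (rank-mono-< xs v∈xs v<u))

OrderMatching : (ℕ → ℕ → Set) → Set
OrderMatching R = ∀ {x y x' y'} → R x y → R x' y' → (x' < x → y' < y) × (y' < y → x' < x)

module OrderMatched (R : ℕ → ℕ → Set) (matching : OrderMatching R) where

  countBelow-matched : ∀ {u v xs ys} → R u v → Pointwise R xs ys → countBelow u xs ≡ countBelow v ys
  countBelow-matched r [] = refl
  countBelow-matched {u} {v} r (_∷_ {x} {y} {xs} {ys} r' rs) with x <? u | y <? v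
  ... | yes p | yes q rewrite countBelow-∷< xs p | countBelow-∷< ys q = cong suc (countBelow-matched r rs)
  ... | yes p | no ¬q = ⊥-elim (¬q (proj₁ (matching r r') p))
  ... | no ¬p | yes q = ⊥-elim (¬p (proj₂ (matching r r') q))
  ... | no ¬p | no ¬q rewrite countBelow-∷≮ xs ¬p | countBelow-∷≮ ys ¬q = countBelow-matched r rs

  ranks-matched : ∀ {xs ys us vs} → Pointwise R xs ys → Pointwise R us vs → map (rank xs) us ≡ map (rank ys) vs
  ranks-matched rs [] = refl
  ranks-matched rs (r ∷ rs') = cong₂ _∷_ (cong suc (countBelow-matched r rs)) (ranks-matched rs rs')

  std-matched : ∀ {xs ys} → Pointwise R xs ys → std xs ≡ std ys
  std-matched rs = ranks-matched rs rs

RankOf : List ℕ → ℕ → ℕ → Set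
RankOf xs x y = (x ∈ xs) × (y ≡ rank xs x)

rankOf-matching : ∀ xs → OrderMatching (RankOf xs)
rankOf-matching xs (u∈ , refl) (v∈ , refl) = rank-mono-< xs v∈ , rank-reflects-< xs v∈ u∈

std-ranks : ∀ xs us → All (_∈ xs) us → std (map (rank xs) us) ≡ std us
std-ranks xs us us⊆xs = sym (OrderMatched.std-matched (RankOf xs) (rankOf-matching xs) (matchRanks us us⊆xs))
  where
  matchRanks : ∀ us → All (_∈ xs) us → Pointwise (RankOf xs) us (map (rank xs) us)
  matchRanks [] [] = []
  matchRanks (u ∷ us) (u∈ ∷ us⊆xs) = (u∈ , refl) ∷ matchRanks us us⊆xs

entries : ∀ (xs : List ℕ) → All (_∈ xs) xs
entries xs = All.tabulate (λ x∈ → x∈)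

std-std : ∀ xs → std (std xs) ≡ std xs
std-std xs = std-ranks xs xs (entries xs)

factor : ℕ → ℕ → List ℕ → List ℕ
factor o e xs = take e (drop o xs)

std-factor-std : ∀ o e xs → std (factor o e (std xs)) ≡ std (factor o e xs)
std-factor-std o e xs =
  trans (cong std (trans (cong (take e) (drop-map o xs)) (take-map e (drop o xs))))
        (std-ranks xs (factor o e xs) (take⁺ e (drop⁺ o (entries xs))))

factor-factor : ∀ A o e L (xs : List ℕ) → o + e ≤ L → factor o e (factor A L xs) ≡ factor (A + o) e xs
factor-factor zero zero e L xs e≤L = take-take≤ e L xs e≤L
  where
  take-take≤ : ∀ e L (xs : List ℕ) → e ≤ L → take e (take L xs) ≡ take e xs
  take-take≤ zero L xs _ = refl
  take-take≤ (suc e) (suc L) [] _ = refl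
  take-take≤ (suc e) (suc L) (x ∷ xs) (s≤s e≤L) = cong (x ∷_) (take-take≤ e L xs e≤L)
factor-factor zero (suc o) e zero [] _ = refl
factor-factor zero (suc o) e (suc L) [] _ = refl
factor-factor zero (suc o) e (suc L) (x ∷ xs) (s≤s le) = factor-factor zero o e L xs le
factor-factor (suc A) o e L [] le = trans (cong (λ z → take e (drop o z)) (take-[] L)) (cong (take e) (drop-[] o))
factor-factor (suc A) o e L (x ∷ xs) le = factor-factor A o e L xs le

ascending : ℕ → List ℕ
ascending zero = []
ascending (suc L) = 1 ∷ map suc (ascending L)

descending : ℕ → List ℕ
descending zero = []
descending (suc L) = suc L ∷ descending L

private
  map-congᴬ : ∀ {f g : ℕ → ℕ} {xs} → All (λ x → f x ≡ g x) xs → map f xs ≡ map g xs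
  map-congᴬ [] = refl
  map-congᴬ (p ∷ ps) = cong₂ _∷_ p (map-congᴬ ps)

  countBelow-none : ∀ {u} xs → All (λ y → ¬ y < u) xs → countBelow u xs ≡ 0
  countBelow-none [] [] = refl
  countBelow-none (y ∷ ys) (p ∷ ps) = trans (countBelow-∷≮ ys p) (countBelow-none ys ps)

  countBelow-all : ∀ {u} xs → All (_< u) xs → countBelow u xs ≡ length xs
  countBelow-all [] [] = refl
  countBelow-all (y ∷ ys) (p ∷ ps) = trans (countBelow-∷< ys p) (cong suc (countBelow-all ys ps))

  linked-head : ∀ {R : ℕ → ℕ → Set} → (∀ {a b c} → R a b → R b c → R a c) →
    ∀ {x xs} → Linked R (x ∷ xs) → All (R x) xs
  linked-head tr [-] = []
  linked-head tr (r ∷ l) = Linked⇒All tr r l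

std-ascending : ∀ xs → Linked _<_ xs → std xs ≡ ascending (length xs)
std-ascending [] _ = refl
std-ascending (x ∷ xs) l = cong₂ _∷_ head≡1 (trans tail≡ (cong (map suc) (std-ascending xs (Linked.tail l))))
  where
  x<xs : All (x <_) xs
  x<xs = linked-head <-trans l
  head≡1 : rank (x ∷ xs) x ≡ 1
  head≡1 = cong suc (trans (countBelow-∷≮ xs (<-irrefl refl)) (countBelow-none xs (All.map <-asym x<xs)))
  tail≡ : map (rank (x ∷ xs)) xs ≡ map suc (map (rank xs) xs)
  tail≡ = trans (map-congᴬ (All.map (λ x<y → cong suc (countBelow-∷< xs x<y)) x<xs)) (map-∘ xs)

std-descending : ∀ xs → Linked _>_ xs → std xs ≡ descending (length xs)
std-descending [] _ = refl
std-descending (x ∷ xs) l = cong₂ _∷_ head≡ (trans tail≡ (std-descending xs (Linked.tail l)))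
  where
  xs<x : All (_< x) xs
  xs<x = linked-head (λ p q → <-trans q p) l
  head≡ : rank (x ∷ xs) x ≡ suc (length xs)
  head≡ = cong suc (trans (countBelow-∷≮ xs (<-irrefl refl)) (countBelow-all xs xs<x))
  tail≡ : map (rank (x ∷ xs)) xs ≡ map (rank xs) xs
  tail≡ = map-congᴬ (All.map (λ y<x → cong suc (countBelow-∷≮ xs (<-asym y<x))) xs<x)

private
  linked-take : ∀ {R : ℕ → ℕ → Set} m xs → Linked R xs → Linked R (take m xs)
  linked-take zero xs l = []
  linked-take (suc m) [] l = []
  linked-take (suc zero) (x ∷ xs) l = [-]
  linked-take (suc (suc m)) (x ∷ []) l = [-]
  linked-take (suc (suc m)) (x ∷ y ∷ xs) (r ∷ l) = r ∷ linked-take (suc m) (y ∷ xs) l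

  linked-drop1 : ∀ {R : ℕ → ℕ → Set} xs → Linked R xs → Linked R (drop 1 xs)
  linked-drop1 [] l = []
  linked-drop1 (x ∷ xs) l = Linked.tail l

  length-init≡length-tail : ∀ (xs : List ℕ) → length (take (length xs ∸ 1) xs) ≡ length (drop 1 xs)
  length-init≡length-tail xs =
    trans (length-take (length xs ∸ 1) xs) (trans (m≤n⇒m⊓n≡m (m∸n≤m (length xs) 1)) (sym (length-drop 1 xs)))

std-init≡std-tail : ∀ xs → Monotone xs → std (take (length xs ∸ 1) xs) ≡ std (drop 1 xs)
std-init≡std-tail xs (inj₁ l) =
  trans (std-ascending _ (linked-take _ xs l))
        (trans (cong ascending (length-init≡length-tail xs)) (sym (std-ascending _ (linked-drop1 xs l))))
std-init≡std-tail xs (inj₂ l) =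
  trans (std-descending _ (linked-take _ xs l))
        (trans (cong descending (length-init≡length-tail xs)) (sym (std-descending _ (linked-drop1 xs l))))

countBelow-↭ : ∀ {u xs ys} → xs ↭ ys → countBelow u xs ≡ countBelow u ys
countBelow-↭ {u} p = ↭-length (filter-↭ (_<? u) p)

countBelow-map-suc : ∀ u ys → countBelow (suc u) (map suc ys) ≡ countBelow u ys
countBelow-map-suc u [] = refl
countBelow-map-suc u (y ∷ ys) with y <? u
... | yes y<u = trans (countBelow-∷< (map suc ys) (s≤s y<u))
                      (trans (cong suc (countBelow-map-suc u ys)) (sym (countBelow-∷< ys y<u)))
... | no y≮u = trans (countBelow-∷≮ (map suc ys) (λ { (s≤s y<u) → y≮u y<u }))
                     (trans (countBelow-map-suc u ys) (sym (countBelow-∷≮ ys y≮u)))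

countBelow-upTo : ∀ k d → k ≤ d → countBelow k (upTo d) ≡ k
countBelow-upTo zero d _ = countBelow-none (upTo d) (All.tabulate (λ _ ()))
countBelow-upTo (suc k) (suc d) (s≤s k≤d) =
  trans (countBelow-∷< (applyUpTo suc d) (s≤s z≤n))
        (cong suc (trans (cong (countBelow (suc k)) (sym (map-applyUpTo (λ x → x) suc d)))
                         (trans (countBelow-map-suc k (upTo d)) (countBelow-upTo k d k≤d))))

std-perm : ∀ τ → IsPerm τ → std τ ≡ τ
std-perm τ (_ , τ↭) = trans (map-congᴬ (All.tabulate rank≡)) (map-id τ)
  where
  rank≡ : ∀ {x} → x ∈ τ → rank τ x ≡ x
  rank≡ x∈ with ∈-map⁻ suc (∈-resp-↭ τ↭ x∈)
  ... | k , k∈ , refl = cong suc (trans (countBelow-↭ τ↭)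
    (trans (countBelow-map-suc k (upTo (length τ))) (countBelow-upTo k (length τ) (<⇒≤ (∈-upTo⁻ k∈)))))

-- The consecutive pattern order.

IsStd : List ℕ → Set
IsStd xs = std xs ≡ xs

≼-std : ∀ {σ τ} → σ ≼ τ → IsStd σ
≼-std (i , _ , occ) = trans (cong std (sym occ)) (trans (std-std _) occ)

≼-length : ∀ {σ τ} → σ ≼ τ → length σ ≤ length τ
≼-length {σ} (i , fits , _) = ≤-trans (m≤n+m (length σ) i) fits

-- A standard list is the only pattern of its own length that it contains.
≺-length : ∀ {σ τ} → σ ≺ τ → IsStd τ → length σ < length τ
≺-length {σ} {τ} ((i , fits , occ) , σ≢τ) stdτ with m≤n⇒m<n∨m≡n (≼-length (i , fits , occ))
... | inj₁ lt = lt
... | inj₂ eq = ⊥-elim (σ≢τ (trans (sym occ) (trans (cong std whole) stdτ)))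
  where
  i≡0 : i ≡ 0
  i≡0 = n≤0⇒n≡0 (≤-trans (m+n≤o⇒m≤o∸n i fits)
    (≤-reflexive (trans (cong (_∸ length σ) (sym eq)) (n∸n≡0 (length σ)))))
  whole : take (length σ) (drop i τ) ≡ τ
  whole = trans (cong (λ z → take (length σ) (drop z τ)) i≡0) (take-all (length σ) τ (≤-reflexive (sym eq)))

cover-by-length : ∀ {X Y} → X ≼ Y → suc (length X) ≡ length Y → IsStd Y → X ⋖ Y
cover-by-length {X} {Y} X≼Y lenXY stdY = (X≼Y , λ { refl → 1+n≢n lenXY }) ,
  λ π _ (X≺π , π≺Y) → <-irrefl refl
    (<-≤-trans (≺-length π≺Y stdY) (subst (_≤ length π) lenXY (≺-length X≺π (≼-std (proj₁ π≺Y)))))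

drop-cover : ∀ m (x : List ℕ) → suc m ≤ length x → std (drop (suc m) x) ⋖ std (drop m x)
drop-cover m x m<len = cover-by-length tail≼ lenE (std-std (drop m x))
  where
  X : List ℕ
  X = std (drop (suc m) x)
  lenX : length X ≡ length (drop (suc m) x)
  lenX = length-map _ (drop (suc m) x)
  lenE : suc (length X) ≡ length (std (drop m x))
  lenE = trans (cong suc (trans lenX (length-drop (suc m) x)))
    (trans (sym (+-∸-assoc 1 m<len)) (trans (sym (length-drop m x)) (sym (length-map _ (drop m x)))))
  tail≼ : X ≼ std (drop m x)
  tail≼ = 1 , ≤-reflexive lenE , trans (std-factor-std 1 (length X) (drop m x))
    (cong std (trans (cong (take (length X)) (trans (drop-drop m 1 x) (cong (λ z → drop z x) (+-comm m 1))))
                     (take-all (length X) (drop (suc m) x) (≤-reflexive (sym lenX)))))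

-- Occurrences: x occurs in τ at offset A when the factor of τ at positions
-- A+1,…,A+|x| has standard form x.
OccursAt : List ℕ → ℕ → List ℕ → Set
OccursAt τ A x = std (factor A (length x) τ) ≡ x

occurrence-factor : ∀ τ A {x} → OccursAt τ A x → ∀ o e → o + e ≤ length x →
  std (factor o e x) ≡ std (factor (A + o) e τ)
occurrence-factor τ A {x} occ o e fits =
  trans (cong (λ z → std (factor o e z)) (sym occ))
        (trans (std-factor-std o e (factor A (length x) τ)) (cong std (factor-factor A o e (length x) τ fits)))

occurrence-prefix : ∀ τ A {x} → OccursAt τ A x → ∀ e → e ≤ length x → prefix e x ≡ std (factor A e τ)
occurrence-prefix τ A occ e e≤ =
  trans (occurrence-factor τ A occ 0 e e≤) (cong (λ z → std (factor z e τ)) (+-identityʳ A))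

occurrence-suffix : ∀ τ A {x} → OccursAt τ A x → ∀ e → e ≤ length x →
  suffix e x ≡ std (factor (A + (length x ∸ e)) e τ)
occurrence-suffix τ A {x} occ e e≤ =
  trans (cong std (sym (take-all e (drop (length x ∸ e) x)
                         (≤-reflexive (trans (length-drop (length x ∸ e) x) (m∸[m∸n]≡n e≤))))))
        (occurrence-factor τ A occ (length x ∸ e) e (≤-reflexive (m∸n+n≡m e≤)))

occurrence-interior : ∀ τ {A x B y} → OccursAt τ A x → OccursAt τ B y →
  A < B → B + length y < A + length x → y ≼ interior x
occurrence-interior τ {A} {x} {B} {y} occX occY A<B inside = o , fits , inInterior
  where
  d e o : ℕ
  d = length x
  e = length y
  o = B ∸ suc A
  B≡ : A + suc o ≡ B
  B≡ = trans (+-suc A o) (m+[n∸m]≡n A<B)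
  Z : List ℕ
  Z = drop 1 (take (d ∸ 1) x)
  room : suc (suc o + e) ≤ d
  room = +-cancelˡ-≤ A _ _ (begin
    A + suc (suc o + e)   ≡⟨ +-suc A (suc o + e) ⟩
    suc (A + (suc o + e)) ≡⟨ cong suc (sym (+-assoc A (suc o) e)) ⟩
    suc (A + suc o + e)   ≡⟨ cong (λ z → suc (z + e)) B≡ ⟩
    suc (B + e)           ≤⟨ inside ⟩
    A + d                 ∎)
    where open ≤-Reasoning
  so+e≤ : suc o + e ≤ d ∸ 1
  so+e≤ = m+n≤o⇒m≤o∸n (suc o + e) (subst (_≤ d) (+-comm 1 (suc o + e)) room)
  fits : o + e ≤ length (interior x)
  fits = subst (o + e ≤_) (sym lenZ) (m+n≤o⇒m≤o∸n (o + e) (subst (_≤ d ∸ 1) (+-comm 1 (o + e)) so+e≤))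
    where
    lenZ : length (std Z) ≡ d ∸ 1 ∸ 1
    lenZ = trans (length-map _ Z) (trans (length-drop 1 (take (d ∸ 1) x))
                 (cong (_∸ 1) (trans (length-take (d ∸ 1) x) (m≤n⇒m⊓n≡m (m∸n≤m d 1)))))
  inInterior : std (factor o e (std Z)) ≡ y
  inInterior = begin
    std (factor o e (std Z))                  ≡⟨ std-factor-std o e Z ⟩
    std (take e (drop o Z))                   ≡⟨ cong (λ z → std (take e z)) (drop-drop 1 o (take (d ∸ 1) x)) ⟩
    std (factor (suc o) e (factor 0 (d ∸ 1) x)) ≡⟨ cong std (factor-factor 0 (suc o) e (d ∸ 1) x so+e≤) ⟩
    std (factor (suc o) e x)                  ≡⟨ occurrence-factor τ A occX (suc o) e (≤-trans so+e≤ (m∸n≤m d 1)) ⟩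
    std (factor (A + suc o) e τ)              ≡⟨ cong (λ z → std (factor z e τ)) B≡ ⟩
    std (factor B e τ)                        ≡⟨ occY ⟩
    y                                         ∎
    where open ≡-Reasoning

-- The chain id as the output of a labelling automaton.
-- The state is the current window {a,…,b}; reading a cover x → y emits a label
-- and moves to the next window, exactly as in the definition of `labels`.

Window : Set
Window = ℕ × ℕ

labelStep : List ℕ → Window → List ℕ → List ℕ → ℕ × Window
labelStep τ (a , b) x y with monotone? x
... | yes _ = a , (suc a , b)
... | no _ with ≡-dec _≟_ (std (window τ (suc a) b)) y
...   | yes _ = a , (suc a , b)
...   | no _ = b , (a , b ∸ 1)

-- The three cases of `labelStep`: delete the first letter (monotone x, or the tail
-- of the window has the right pattern), otherwise delete the last letter.
labelStep-monotone : ∀ τ a b {x y} → Monotone x → labelStep τ (a , b) x y ≡ (a , (suc a , b))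
labelStep-monotone τ a b {x} mono with monotone? x
... | yes _ = refl
... | no notMono = ⊥-elim (notMono mono)

labelStep-tail : ∀ τ a b {x y} → std (window τ (suc a) b) ≡ y → labelStep τ (a , b) x y ≡ (a , (suc a , b))
labelStep-tail τ a b {x} {y} tailOcc with monotone? x
... | yes _ = refl
... | no _ with ≡-dec _≟_ (std (window τ (suc a) b)) y
...   | yes _ = refl
...   | no notTail = ⊥-elim (notTail tailOcc)

labelStep-init : ∀ τ a b {x y} → ¬ Monotone x → std (window τ (suc a) b) ≢ y →
  labelStep τ (a , b) x y ≡ (b , (a , b ∸ 1))
labelStep-init τ a b {x} {y} notMono notTail with monotone? x
... | yes mono = ⊥-elim (notMono mono)
... | no _ with ≡-dec _≟_ (std (window τ (suc a) b)) y
...   | yes tailOcc = ⊥-elim (notTail tailOcc)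
...   | no _ = refl

windowAt : List ℕ → Window → (ℕ → List ℕ) → ℕ → Window
windowAt τ w f zero = w
windowAt τ w f (suc k) = proj₂ (labelStep τ (windowAt τ w f k) (f k) (f (suc k)))

labelAt : List ℕ → Window → (ℕ → List ℕ) → ℕ → ℕ
labelAt τ w f k = proj₁ (labelStep τ (windowAt τ w f k) (f k) (f (suc k)))

windowAt-agree : ∀ τ w (f g : ℕ → List ℕ) k → (∀ m → m ≤ k → f m ≡ g m) →
  windowAt τ w f k ≡ windowAt τ w g k
windowAt-agree τ w f g zero f≗g = refl
windowAt-agree τ w f g (suc k) f≗g =
  cong₂ (λ v xy → proj₂ (labelStep τ v (proj₁ xy) (proj₂ xy)))
        (windowAt-agree τ w f g k (λ m m≤k → f≗g m (m≤n⇒m≤1+n m≤k)))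
        (cong₂ _,_ (f≗g k (n≤1+n k)) (f≗g (suc k) ≤-refl))

labelAt-agree : ∀ τ w (f g : ℕ → List ℕ) k → (∀ m → m ≤ suc k → f m ≡ g m) →
  labelAt τ w f k ≡ labelAt τ w g k
labelAt-agree τ w f g k f≗g =
  cong₂ (λ v xy → proj₁ (labelStep τ v (proj₁ xy) (proj₂ xy)))
        (windowAt-agree τ w f g k (λ m m≤k → f≗g m (m≤n⇒m≤1+n m≤k)))
        (cong₂ _,_ (f≗g k (n≤1+n k)) (f≗g (suc k) ≤-refl))

-- A chain read as a sequence indexed by ℕ (constant after its last element).
clamp : (n : ℕ) → ℕ → Fin (suc n)
clamp n zero = fz
clamp zero (suc k) = fz
clamp (suc n) (suc k) = fs (clamp n k)

at : {n : ℕ} → Chain n → ℕ → List ℕ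
at {n} ρ k = ρ (clamp n k)

clamp-toℕ : ∀ n (k : Fin (suc n)) → clamp n (toℕ k) ≡ k
clamp-toℕ n fz = refl
clamp-toℕ (suc n) (fs k) = cong fs (clamp-toℕ n k)

clamp-inject₁ : ∀ n (k : Fin n) → clamp n (toℕ k) ≡ inject₁ k
clamp-inject₁ (suc n) fz = refl
clamp-inject₁ (suc n) (fs k) = cong fs (clamp-inject₁ n k)

clamp-suc : ∀ n (k : Fin n) → clamp n (suc (toℕ k)) ≡ fs k
clamp-suc (suc n) fz = refl
clamp-suc (suc n) (fs k) = cong fs (clamp-suc n k)

clamp-last : ∀ n → clamp n n ≡ fromℕ n
clamp-last zero = refl
clamp-last (suc n) = cong fs (clamp-last n)

toℕ-clamp : ∀ n k → k ≤ n → toℕ (clamp n k) ≡ k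
toℕ-clamp n zero _ = refl
toℕ-clamp (suc n) (suc k) (s≤s k≤n) = cong suc (toℕ-clamp n k k≤n)

labels≡labelAt : ∀ n τ a b (ρ : Chain n) → labels τ a b ρ ≡ applyUpTo (labelAt τ (a , b) (at ρ)) n
labels≡labelAt zero τ a b ρ = refl
labels≡labelAt (suc n) τ a b ρ =
  trans (unfold a b ρ) (cong (labelAt τ (a , b) (at ρ) 0 ∷_)
    (trans (labels≡labelAt n τ _ _ (λ k → ρ (fs k)))
           (applyUpTo-cong n (λ k → cong (λ w → proj₁ (labelStep τ w (at ρ (suc k)) (at ρ (suc (suc k)))))
                                         (sym (windowAt-shift (at ρ) k))))))
  where
  unfold : ∀ {n} a b (ρ : Chain (suc n)) → labels τ a b ρ ≡
    proj₁ (labelStep τ (a , b) (ρ fz) (ρ (fs fz))) ∷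
    labels τ (proj₁ (proj₂ (labelStep τ (a , b) (ρ fz) (ρ (fs fz)))))
             (proj₂ (proj₂ (labelStep τ (a , b) (ρ fz) (ρ (fs fz))))) (λ k → ρ (fs k))
  unfold a b ρ with monotone? (ρ fz)
  ... | yes _ = refl
  ... | no _ with ≡-dec _≟_ (std (window τ (suc a) b)) (ρ (fs fz))
  ...   | yes _ = refl
  ...   | no _ = refl
  windowAt-shift : ∀ (f : ℕ → List ℕ) k →
    windowAt τ (a , b) f (suc k) ≡ windowAt τ (proj₂ (labelStep τ (a , b) (f 0) (f 1))) (λ m → f (suc m)) k
  windowAt-shift f zero = refl
  windowAt-shift f (suc k) = cong (λ w → proj₂ (labelStep τ w (f (suc k)) (f (suc (suc k))))) (windowAt-shift f k)
  applyUpTo-cong : ∀ {g h : ℕ → ℕ} n → (∀ k → g k ≡ h k) → applyUpTo g n ≡ applyUpTo h n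
  applyUpTo-cong zero g≗h = refl
  applyUpTo-cong (suc n) g≗h = cong₂ _∷_ (g≗h 0) (applyUpTo-cong n (λ k → g≗h (suc k)))

windowOf : ℕ → List ℕ → Window
windowOf A x = suc A , A + length x

data Step (τ : List ℕ) (A : ℕ) (x y : List ℕ) : Set where
  left  : labelStep τ (windowOf A x) x y ≡ (suc A , windowOf (suc A) y) → OccursAt τ (suc A) y → Step τ A x y
  right : labelStep τ (windowOf A x) x y ≡ (A + length x , windowOf A y) → OccursAt τ A y → Step τ A x y

tail-window : ∀ τ A (x : List ℕ) L → length x ≡ suc L → window τ (suc (suc A)) (A + length x) ≡ factor (suc A) L τ
tail-window τ A x L lenx = cong (λ z → take z (drop (suc A) τ))
  (trans (cong (λ z → A + z ∸ suc A) lenx) (trans (cong (_∸ suc A) (+-suc A L)) (m+n∸m≡n A L)))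

tail-occurrence : ∀ τ A x L → OccursAt τ A x → length x ≡ suc L → std (factor 1 L x) ≡ std (factor (suc A) L τ)
tail-occurrence τ A x L occX lenx =
  trans (occurrence-factor τ A occX 1 L (≤-reflexive (sym lenx))) (cong (λ z → std (factor z L τ)) (+-comm A 1))

step : ∀ τ A x y → length x ≡ suc (length y) → OccursAt τ A x → y ≼ x → Step τ A x y
step τ A x y lenx occX (o , fits , occY) = classify
  where
  L : ℕ
  L = length y
  o≤1 : o ≤ 1
  o≤1 = +-cancelʳ-≤ L o 1 (≤-trans fits (≤-reflexive lenx))
  fits1 : 1 + L ≤ length x
  fits1 = ≤-reflexive (sym lenx)
  tail≡ : std (window τ (suc (suc A)) (A + length x)) ≡ std (factor 1 L x)
  tail≡ = trans (cong std (tail-window τ A x L lenx)) (sym (tail-occurrence τ A x L occX lenx))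
  leftWindow : (suc A , (suc (suc A) , A + length x)) ≡ (suc A , windowOf (suc A) y)
  leftWindow = cong (λ z → suc A , (suc (suc A) , z)) (trans (cong (A +_) lenx) (+-suc A L))
  rightWindow : (A + length x , (suc A , A + length x ∸ 1)) ≡ (A + length x , windowOf A y)
  rightWindow = cong (λ z → A + length x , (suc A , z ∸ 1)) (trans (cong (A +_) lenx) (+-suc A L))
  classify : Step τ A x y
  classify with monotone? x
  ... | yes mono = left (trans (labelStep-monotone τ (suc A) (A + length x) {x} mono) leftWindow)
                        (trans (sym (tail-occurrence τ A x L occX lenx)) (trans (sym initial≡tail) (startOrEnd o o≤1 occY)))
    where
    initial≡tail : std (factor 0 L x) ≡ std (factor 1 L x)
    initial≡tail = trans (cong (λ z → std (take z x)) (sym (cong (_∸ 1) lenx)))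
      (trans (std-init≡std-tail x mono)
             (cong std (sym (take-all L (drop 1 x) (≤-reflexive (trans (length-drop 1 x) (cong (_∸ 1) lenx)))))))
    startOrEnd : ∀ o → o ≤ 1 → std (factor o L x) ≡ y → std (factor 0 L x) ≡ y
    startOrEnd zero _ occ = occ
    startOrEnd (suc zero) _ occ = trans initial≡tail occ
    startOrEnd (suc (suc o)) (s≤s ()) _
  ... | no notMono with ≡-dec _≟_ (std (window τ (suc (suc A)) (A + length x))) y
  ...   | yes tailOcc = left (trans (labelStep-tail τ (suc A) (A + length x) {x} tailOcc) leftWindow)
                             (trans (cong std (sym (tail-window τ A x L lenx))) tailOcc)
  ...   | no notTail = right (trans (labelStep-init τ (suc A) (A + length x) notMono notTail) rightWindow)
                             (start o o≤1 occY)
    where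
    start : ∀ o → o ≤ 1 → std (factor o L x) ≡ y → std (factor A L τ) ≡ y
    start zero _ occ = trans (sym (occurrence-prefix τ A occX L (≤-trans (n≤1+n L) fits1))) occ
    start (suc zero) _ occ = ⊥-elim (notTail (trans tail≡ occ))
    start (suc (suc o)) (s≤s ()) _

-- Lexicographic order and decreasing segments of lists of the form applyUpTo g n.

lex-applyUpTo-intro : ∀ n (g h : ℕ → ℕ) k → k < n → (∀ m → m < k → g m ≡ h m) → g k < h k →
  Lex-< _≡_ _<_ (applyUpTo g n) (applyUpTo h n)
lex-applyUpTo-intro (suc n) g h zero _ _ lt = this lt
lex-applyUpTo-intro (suc n) g h (suc k) (s≤s k<n) agree lt =
  next (agree 0 z<s) (lex-applyUpTo-intro n (λ m → g (suc m)) (λ m → h (suc m)) k k<n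
                        (λ m m<k → agree (suc m) (s≤s m<k)) lt)

lex-applyUpTo-elim : ∀ n (g h : ℕ → ℕ) → Lex-< _≡_ _<_ (applyUpTo g n) (applyUpTo h n) →
  Σ ℕ λ k → (k < n) × (∀ m → m < k → g m ≡ h m) × (g k < h k)
lex-applyUpTo-elim zero g h (base ())
lex-applyUpTo-elim (suc n) g h (this lt) = 0 , z<s , (λ m ()) , lt
lex-applyUpTo-elim (suc n) g h (next g0≡h0 rest) with lex-applyUpTo-elim n (λ m → g (suc m)) (λ m → h (suc m)) rest
... | k , k<n , agree , lt = suc k , s≤s k<n , (λ { zero _ → g0≡h0 ; (suc m) (s≤s m<k) → agree m m<k }) , lt

private
  drop-applyUpTo : ∀ i n (h : ℕ → ℕ) → drop i (applyUpTo h n) ≡ applyUpTo (λ m → h (i + m)) (n ∸ i)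
  drop-applyUpTo zero n h = refl
  drop-applyUpTo (suc i) zero h = refl
  drop-applyUpTo (suc i) (suc n) h = drop-applyUpTo i n (λ m → h (suc m))

  take-applyUpTo : ∀ m N (g : ℕ → ℕ) → m ≤ N → take m (applyUpTo g N) ≡ applyUpTo g m
  take-applyUpTo zero N g _ = refl
  take-applyUpTo (suc m) (suc N) g (s≤s m≤N) = cong (g 0 ∷_) (take-applyUpTo m N (λ k → g (suc k)) m≤N)

  linked-applyUpTo : ∀ m (g : ℕ → ℕ) → Linked _>_ (applyUpTo g m) → ∀ t → suc t < m → g (suc t) < g t
  linked-applyUpTo (suc zero) g l zero (s≤s ())
  linked-applyUpTo (suc (suc m)) g (r ∷ l) zero _ = r
  linked-applyUpTo (suc (suc m)) g (r ∷ l) (suc t) (s≤s lt) = linked-applyUpTo (suc m) (λ k → g (suc k)) l t lt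

decreasing-applyUpTo : ∀ n (h : ℕ → ℕ) i j → j ≤ n → i ≤ j →
  Linked _>_ (take (j ∸ i) (drop i (applyUpTo h n))) → ∀ t → i ≤ t → suc t < j → h (suc t) < h t
decreasing-applyUpTo n h i j j≤n i≤j l t i≤t lt = subst₂ (λ u v → h u < h v) i+d+1≡ i+d≡ r
  where
  l' : Linked _>_ (applyUpTo (λ m → h (i + m)) (j ∸ i))
  l' = subst (Linked _>_) (trans (cong (take (j ∸ i)) (drop-applyUpTo i n h))
                                 (take-applyUpTo (j ∸ i) (n ∸ i) _ (∸-monoˡ-≤ i j≤n))) l
  d : ℕ
  d = t ∸ i
  i+d≡ : i + d ≡ t
  i+d≡ = m+[n∸m]≡n i≤t
  i+d+1≡ : i + suc d ≡ suc t
  i+d+1≡ = trans (+-suc i d) (cong suc i+d≡)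
  r : h (i + suc d) < h (i + d)
  r = linked-applyUpTo (j ∸ i) (λ m → h (i + m)) l' d
        (subst (_< j ∸ i) (m+n∸m≡n i (suc d)) (∸-monoˡ-< (subst (_< j) (sym i+d+1≡) lt) (m≤m+n i (suc d))))

steps-compose : {R : ℕ → ℕ → Set} → (∀ {a} → R a a) → (∀ {a b c} → R a b → R b c → R a c) →
  ∀ (g : ℕ → ℕ) n → (∀ k → k < n → R (g k) (g (suc k))) → ∀ m k → m ≤ k → k ≤ n → R (g m) (g k)
steps-compose refl′ trans′ g n stepR m zero z≤n _ = refl′
steps-compose {R} refl′ trans′ g n stepR m (suc k) m≤1+k 1+k≤n with m≤n⇒m<n∨m≡n m≤1+k
... | inj₂ refl = refl′
... | inj₁ (s≤s m≤k) = trans′ (steps-compose {R} refl′ trans′ g n stepR m k m≤k (<⇒≤ 1+k≤n)) (stepR k 1+k≤n)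

-- Every f k has length |τ| - k and occurs in τ at an offset A_k whose window {A_k+1,…,A_k+|f k|}
-- is the automaton state; each step deletes the first letter (A_{k+1} = A_k + 1, label A_k + 1)
-- or the last one (A_{k+1} = A_k, label A_k + |f k|).
module MaximalChain (σ τ : List ℕ) (permσ : IsPerm σ) (permτ : IsPerm τ) (σ≤τ : length σ ≤ length τ)
  (ρ : Chain (length τ ∸ length σ)) (maximal : IsMaximalChain σ τ ρ) where

  n : ℕ
  n = length τ ∸ length σ

  f : ℕ → List ℕ
  f = at ρ

  f0 : f 0 ≡ τ
  f0 = proj₁ maximal

  fn : f n ≡ σ
  fn = trans (cong ρ (clamp-last n)) (proj₁ (proj₂ maximal))

  cover : ∀ k → k < n → f (suc k) ⋖ f k
  cover k k<n = subst₂ _⋖_ (cong ρ (trans (sym (clamp-suc n kf)) (cong (λ z → clamp n (suc z)) toℕkf)))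
                           (cong ρ (trans (sym (clamp-inject₁ n kf)) (cong (clamp n) toℕkf)))
                           (proj₂ (proj₂ maximal) kf)
    where
    kf : Fin n
    kf = fromℕ< k<n
    toℕkf : toℕ kf ≡ k
    toℕkf = toℕ-fromℕ< k<n

  isStd : ∀ k → k ≤ n → IsStd (f k)
  isStd zero _ = subst IsStd (sym f0) (std-perm τ permτ)
  isStd (suc k) k<n = ≼-std (proj₁ (proj₁ (cover k k<n)))

  private
    length-shrinks : ∀ d k → k + d ≤ n → length (f (k + d)) + d ≤ length (f k)
    length-shrinks zero k _ rewrite +-identityʳ k | +-identityʳ (length (f k)) = ≤-refl
    length-shrinks (suc d) k k+d<n rewrite +-suc k d | +-suc (length (f (suc (k + d)))) d =
      ≤-trans (+-monoˡ-≤ d (≺-length (proj₁ (cover (k + d) k+d<n)) (isStd (k + d) (<⇒≤ k+d<n))))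
              (length-shrinks d k (<⇒≤ k+d<n))

    length-σ+ : ∀ k → k ≤ n → length σ + (n ∸ k) ≤ length (f k)
    length-σ+ k k≤n = subst (λ z → length z + (n ∸ k) ≤ length (f k)) (trans (cong f (m+[n∸m]≡n k≤n)) fn)
                            (length-shrinks (n ∸ k) k (≤-reflexive (m+[n∸m]≡n k≤n)))

  length-at : ∀ k → k ≤ n → length (f k) + k ≡ length τ
  length-at k k≤n = ≤-antisym (≤-trans (length-shrinks k 0 k≤n) (≤-reflexive (cong length f0))) (begin
    length τ                   ≡⟨ sym (m+[n∸m]≡n σ≤τ) ⟩
    length σ + n               ≡⟨ cong (length σ +_) (sym (m∸n+n≡m k≤n)) ⟩
    length σ + (n ∸ k + k)     ≡⟨ sym (+-assoc (length σ) (n ∸ k) k) ⟩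
    length σ + (n ∸ k) + k     ≤⟨ +-monoˡ-≤ k (length-σ+ k k≤n) ⟩
    length (f k) + k           ∎)
    where open ≤-Reasoning

  length-step : ∀ k → k < n → length (f k) ≡ suc (length (f (suc k)))
  length-step k k<n = +-cancelʳ-≡ k _ _
    (trans (length-at k (<⇒≤ k<n)) (trans (sym (length-at (suc k) k<n)) (+-suc _ k)))

  -- before the last step at least two letters remain, so a first letter precedes a last one
  first<last : ∀ k A → k < n → suc A < A + length (f k)
  first<last k A k<n = subst (suc A <_) (sym (trans (cong (A +_) (length-step k k<n)) (+-suc A _)))
    (s≤s (m<m+n A (<-≤-trans (proj₁ permσ) (m+n≤o⇒m≤o (length σ) (length-σ+ (suc k) k<n)))))

  state : ℕ → Window
  state = windowAt τ (1 , length τ) f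

  label : ℕ → ℕ
  label = labelAt τ (1 , length τ) f

  offset : ℕ → ℕ
  offset k = pred (proj₁ (state k))

  Located : ℕ → Set
  Located k = (state k ≡ windowOf (offset k) (f k)) × OccursAt τ (offset k) (f k)

  private
    locate : ∀ k A → state k ≡ windowOf A (f k) → OccursAt τ A (f k) → Located k
    locate k A w≡ occ = subst (λ B → (state k ≡ windowOf B (f k)) × OccursAt τ B (f k)) (sym offset≡) (w≡ , occ)
      where
      offset≡ : offset k ≡ A
      offset≡ = cong (λ w → pred (proj₁ w)) w≡

  -- Proved together by induction on k: once f k is located, `step` classifies the cover
  -- f k → f (k+1) and locates f (k+1).
  located : ∀ k → k ≤ n → Located k
  transition : ∀ k → k < n →
    labelStep τ (state k) (f k) (f (suc k)) ≡ labelStep τ (windowOf (offset k) (f k)) (f k) (f (suc k))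
  stepAt : ∀ k → k < n → Step τ (offset k) (f k) (f (suc k))

  stepAt k k<n = step τ (offset k) (f k) (f (suc k)) (length-step k k<n)
                      (proj₂ (located k (<⇒≤ k<n))) (proj₁ (proj₁ (cover k k<n)))

  transition k k<n = cong (λ w → labelStep τ w (f k) (f (suc k))) (proj₁ (located k (<⇒≤ k<n)))

  located zero _ = locate 0 0 (cong (λ x → 1 , length x) (sym f0))
    (subst (λ x → std (take (length x) τ) ≡ x) (sym f0)
           (trans (cong std (take-all (length τ) τ ≤-refl)) (std-perm τ permτ)))
  located (suc k) k<n with stepAt k k<n
  ... | left  eq occ = locate (suc k) _ (cong proj₂ (trans (transition k k<n) eq)) occ
  ... | right eq occ = locate (suc k) _ (cong proj₂ (trans (transition k k<n) eq)) occ

  data Move (k : ℕ) : Set where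
    dropsFirst : label k ≡ suc (offset k) → offset (suc k) ≡ suc (offset k) → Move k
    dropsLast  : label k ≡ offset k + length (f k) → offset (suc k) ≡ offset k → Move k

  private
    nextOffset : ℕ × Window → ℕ
    nextOffset s = pred (proj₁ (proj₂ s))

  move : ∀ k → k < n → Move k
  move k k<n with stepAt k k<n
  ... | left eq _ = dropsFirst (cong proj₁ (trans (transition k k<n) eq)) (cong nextOffset (trans (transition k k<n) eq))
  ... | right eq _ = dropsLast (cong proj₁ (trans (transition k k<n) eq)) (cong nextOffset (trans (transition k k<n) eq))

  offset-mono : ∀ m k → m ≤ k → k ≤ n → offset m ≤ offset k
  offset-mono = steps-compose {_≤_} ≤-refl ≤-trans offset n offset-step
    where
    offset-step : ∀ k → k < n → offset k ≤ offset (suc k)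
    offset-step k k<n with move k k<n
    ... | dropsFirst _ after = ≤-trans (n≤1+n (offset k)) (≤-reflexive (sym after))
    ... | dropsLast _ after = ≤-reflexive (sym after)

  end : ℕ → ℕ
  end k = offset k + length (f k)

  end-antitone : ∀ m k → m ≤ k → k ≤ n → end k ≤ end m
  end-antitone = steps-compose {λ a b → b ≤ a} ≤-refl (λ p q → ≤-trans q p) end n end-step
    where
    end-step : ∀ k → k < n → end (suc k) ≤ end k
    end-step k k<n with move k k<n
    ... | dropsFirst _ after = ≤-reflexive (trans (cong (_+ length (f (suc k))) after)
                         (sym (trans (cong (offset k +_) (length-step k k<n)) (+-suc (offset k) _))))
    ... | dropsLast _ after = subst (_≤ end k) (cong (_+ length (f (suc k))) (sym after))
                           (+-monoʳ-≤ (offset k) (≤-trans (n≤1+n _) (≤-reflexive (sym (length-step k k<n)))))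

  chainId≡ : chainId τ ρ ≡ applyUpTo label n
  chainId≡ = labels≡labelAt n τ 1 (length τ) ρ

  ρ≡f : ∀ (k : Fin (suc n)) → ρ k ≡ f (toℕ k)
  ρ≡f k = cong ρ (sym (clamp-toℕ n k))

  position-unique : ∀ k k' → k ≤ n → k' ≤ n → length (f k) ≡ length (f k') → k ≡ k'
  position-unique k k' k≤n k'≤n len≡ =
    +-cancelˡ-≡ (length (f k')) k k' (trans (cong (_+ k) (sym len≡)) (trans (length-at k k≤n) (sym (length-at k' k'≤n))))

  position-of : ∀ (m : Fin (suc n)) k → k ≤ n → ρ m ≡ f k → toℕ m ≡ k
  position-of m k k≤n ρm≡ =
    position-unique (toℕ m) k (s≤s⁻¹ (toℕ<n m)) k≤n (cong length (trans (sym (ρ≡f m)) ρm≡))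

  shorter : ∀ k k' → k < k' → k' ≤ n → length (f k') < length (f k)
  shorter k k' k<k' k'≤n = +-cancelʳ-< k' (length (f k')) (length (f k))
    (subst (_< length (f k) + k') (trans (length-at k (≤-trans (<⇒≤ k<k') k'≤n)) (sym (length-at k' k'≤n)))
           (+-monoʳ-< (length (f k)) k<k'))

  length-antitone : ∀ m k → m ≤ k → k ≤ n → length (f k) ≤ length (f m)
  length-antitone m k m≤k k≤n = +-cancelʳ-≤ k (length (f k)) (length (f m))
    (subst (_≤ length (f m) + k) (trans (length-at m (≤-trans m≤k k≤n)) (sym (length-at k k≤n)))
           (+-monoʳ-≤ (length (f m)) m≤k))

module TwoChains (σ τ : List ℕ) (permσ : IsPerm σ) (permτ : IsPerm τ) (σ≤τ : length σ ≤ length τ)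
  (ρ ρ' : Chain (length τ ∸ length σ)) (maxρ : IsMaximalChain σ τ ρ) (maxρ' : IsMaximalChain σ τ ρ') where

  module F = MaximalChain σ τ permσ permτ σ≤τ ρ maxρ
  module G = MaximalChain σ τ permσ permτ σ≤τ ρ' maxρ'
  open F using (n)

  same-length : ∀ k → k ≤ n → length (G.f k) ≡ length (F.f k)
  same-length k k≤n = +-cancelʳ-≡ k _ _ (trans (G.length-at k k≤n) (sym (F.length-at k k≤n)))

  -- Equal labels force equal moves, since a first letter precedes a last letter.
  same-offsets : ∀ k → k ≤ n → (∀ m → m < k → G.label m ≡ F.label m) → G.offset k ≡ F.offset k
  same-offsets zero _ _ = refl
  same-offsets (suc k) k<n labels≡ with same-offsets k (<⇒≤ k<n) (λ m m<k → labels≡ m (m<n⇒m<1+n m<k))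
                                         | G.move k k<n | F.move k k<n
  ... | off≡ | G.dropsFirst _ g+ | F.dropsFirst _ f+ = trans g+ (trans (cong suc off≡) (sym f+))
  ... | off≡ | G.dropsLast _ g+ | F.dropsLast _ f+ = trans g+ (trans off≡ (sym f+))
  ... | off≡ | G.dropsFirst gl _ | F.dropsLast fl _ = ⊥-elim (<-irrefl eq (F.first<last k (F.offset k) k<n))
    where
    eq : suc (F.offset k) ≡ F.offset k + length (F.f k)
    eq = trans (cong suc (sym off≡)) (trans (sym gl) (trans (labels≡ k (n<1+n k)) fl))
  ... | off≡ | G.dropsLast gl _ | F.dropsFirst fl _ = ⊥-elim (<-irrefl eq (F.first<last k (F.offset k) k<n))
    where
    eq : suc (F.offset k) ≡ F.offset k + length (F.f k)
    eq = trans (sym fl) (trans (sym (labels≡ k (n<1+n k))) (trans gl (cong₂ _+_ off≡ (same-length k (<⇒≤ k<n)))))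

  first-difference : ∀ p → p < n → (∀ m → m < p → G.label m ≡ F.label m) → G.label p < F.label p →
    (G.offset (suc p) ≡ suc (F.offset p)) × (F.offset (suc p) ≡ F.offset p)
  first-difference p p<n labels≡ g<f with same-offsets p (<⇒≤ p<n) labels≡ | G.move p p<n | F.move p p<n
  ... | off≡ | G.dropsFirst _ g+ | F.dropsLast _ f+ = trans g+ (cong suc off≡) , f+
  ... | off≡ | G.dropsFirst gl _ | F.dropsFirst fl _ = ⊥-elim (<-irrefl (trans gl (trans (cong suc off≡) (sym fl))) g<f)
  ... | off≡ | G.dropsLast gl _ | F.dropsLast fl _ =
    ⊥-elim (<-irrefl (trans gl (trans (cong₂ _+_ off≡ (same-length p (<⇒≤ p<n))) (sym fl))) g<f)
  ... | off≡ | G.dropsLast gl _ | F.dropsFirst fl _ =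
    ⊥-elim (<-asym g<f (subst₂ _<_ (sym fl) (sym (trans gl (cong₂ _+_ off≡ (same-length p (<⇒≤ p<n)))))
                                  (F.first<last p (F.offset p) p<n)))

  same-label : ∀ k → k < n → (∀ m → m < k → G.label m ≡ F.label m) →
    G.f k ≡ F.f k → G.f (suc k) ≡ F.f (suc k) → G.label k ≡ F.label k
  same-label k k<n labels≡ fk≡ fk+1≡ =
    cong₂ (λ w xy → proj₁ (labelStep τ w (proj₁ xy) (proj₂ xy))) state≡ (cong₂ _,_ fk≡ fk+1≡)
    where
    state≡ : G.state k ≡ F.state k
    state≡ = trans (proj₁ (G.located k (<⇒≤ k<n)))
               (trans (cong₂ windowOf (same-offsets k (<⇒≤ k<n) labels≡) fk≡) (sym (proj₁ (F.located k (<⇒≤ k<n)))))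

module Proposition (σ τ : List ℕ) (permσ : IsPerm σ) (permτ : IsPerm τ) (σ≼τ : σ ≼ τ)
  (ρ : Chain (length τ ∸ length σ)) (maxρ : IsMaximalChain σ τ ρ)
  (i j : Fin (suc (length τ ∸ length σ))) (i<j : toℕ i < toℕ j)
  (exterior : IsExterior (ρ i) (ρ j)) (notInInterior : ¬ (ρ j ≼ interior (ρ i)))
  (decreasing : DecreasingSegment (chainId τ ρ) (toℕ i) (toℕ j)) where

  open MaximalChain σ τ permσ permτ (≼-length σ≼τ) ρ maxρ

  I J : ℕ
  I = toℕ i
  J = toℕ j

  -- Positions: 0 ≤ I < I + 2 ≤ J ≤ n, the decreasing segment having at least two labels.
  J≤n : J ≤ n
  J≤n = s≤s⁻¹ (toℕ<n j)

  I<n : I < n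
  I<n = <-≤-trans i<j J≤n

  I+2≤J : 2 + I ≤ J
  I+2≤J = subst (_≤ J) (+-comm I 2) (subst (I + 2 ≤_) (m+[n∸m]≡n (<⇒≤ i<j)) (+-monoʳ-≤ I (proj₁ decreasing)))

  exteriorF : IsExterior (f I) (f J)
  exteriorF = subst₂ IsExterior (ρ≡f i) (ρ≡f j) exterior

  notInInteriorF : ¬ (f J ≼ interior (f I))
  notInInteriorF = subst₂ (λ x y → ¬ (y ≼ interior x)) (ρ≡f i) (ρ≡f j) notInInterior

  A d e : ℕ
  A = offset I
  d = length (f I)
  e = length (f J)

  occI : OccursAt τ A (f I)
  occI = proj₂ (located I (<⇒≤ I<n))

  -- d = e + (J - I), since lengths drop by one per step
  d≡e+ : d ≡ e + (J ∸ I)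
  d≡e+ = +-cancelʳ-≡ I _ _ (begin
    d + I              ≡⟨ length-at I (<⇒≤ I<n) ⟩
    length τ           ≡⟨ sym (length-at J J≤n) ⟩
    e + J              ≡⟨ cong (e +_) (sym (m∸n+n≡m (<⇒≤ i<j))) ⟩
    e + (J ∸ I + I)    ≡⟨ sym (+-assoc e (J ∸ I) I) ⟩
    e + (J ∸ I) + I    ∎)
    where open ≡-Reasoning

  label-decreasing : ∀ t → I ≤ t → suc t < J → label (suc t) < label t
  label-decreasing = decreasing-applyUpTo n label I J J≤n (<⇒≤ i<j)
    (subst (λ l → Linked _>_ (take (J ∸ I) (drop I l))) chainId≡ (proj₂ decreasing))

  -- Decreasing labels force every step from I up to J-2 to delete the last letter:
  -- after deleting a first letter A_k + 1 every later label is larger.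
  drops-last-inside : ∀ k → I ≤ k → suc k < J → (label k ≡ offset k + length (f k)) × (offset (suc k) ≡ offset k)
  drops-last-inside k I≤k k+1<J = classify (move k (<-trans (n<1+n k) k+1<n))
    where
    k+1<n : suc k < n
    k+1<n = <-≤-trans k+1<J J≤n
    later : offset (suc k) ≡ suc (offset k) → suc (offset k) < label (suc k)
    later o with move (suc k) k+1<n
    ... | dropsFirst l' o' = subst (suc (offset k) <_) (sym (trans l' (cong suc o))) (n<1+n _)
    ... | dropsLast l' o' = subst (suc (offset k) <_) (sym (trans l' (cong (_+ length (f (suc k))) o)))
                              (<-trans (n<1+n _) (first<last (suc k) (suc (offset k)) k+1<n))
    classify : Move k → (label k ≡ offset k + length (f k)) × (offset (suc k) ≡ offset k)
    classify (dropsLast l o) = l , o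
    classify (dropsFirst l o) =
      ⊥-elim (<-asym (label-decreasing k I≤k k+1<J) (subst (_< label (suc k)) (sym l) (later o)))

  offset-inside : ∀ k → I ≤ k → k < J → offset k ≡ A
  offset-inside k I≤k k<J = subst (λ z → offset z ≡ A) (m+[n∸m]≡n I≤k)
    (frozen (k ∸ I) (subst (_< J) (sym (m+[n∸m]≡n I≤k)) k<J))
    where
    frozen : ∀ t → I + t < J → offset (I + t) ≡ A
    frozen zero _ = cong offset (+-identityʳ I)
    frozen (suc t) I+t+1<J rewrite +-suc I t =
      trans (proj₂ (drops-last-inside (I + t) (m≤m+n I t) I+t+1<J)) (frozen t (<-trans (n<1+n _) I+t+1<J))

  -- The earlier chain: between I and J, delete first letters of ρ_I instead,
  -- i.e. pass through the standard forms of the tails of ρ_I.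
  g : ℕ → List ℕ
  g k with I <? k | k <? J
  ... | yes _ | yes _ = std (drop (k ∸ I) (f I))
  ... | _     | _     = f k

  g-outside : ∀ k → k ≤ I ⊎ J ≤ k → g k ≡ f k
  g-outside k outside with I <? k | k <? J
  ... | no _  | _     = refl
  ... | yes _ | no _  = refl
  ... | yes I<k | yes k<J with outside
  ...   | inj₁ k≤I = ⊥-elim (<-irrefl refl (<-≤-trans I<k k≤I))
  ...   | inj₂ J≤k = ⊥-elim (<-irrefl refl (<-≤-trans k<J J≤k))

  g-inside : ∀ k → I < k → k < J → g k ≡ std (drop (k ∸ I) (f I))
  g-inside k I<k k<J with I <? k | k <? J
  ... | yes _ | yes _ = refl
  ... | yes _ | no k≮J = ⊥-elim (k≮J k<J)
  ... | no I≮k | _ = ⊥-elim (I≮k I<k)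

  -- At both ends the tails are ρ_I itself and its suffix x(ρ_I) = ρ_J.
  g-segment : ∀ k → I ≤ k → k ≤ J → g k ≡ std (drop (k ∸ I) (f I))
  g-segment k I≤k k≤J with m≤n⇒m<n∨m≡n I≤k | m≤n⇒m<n∨m≡n k≤J
  ... | inj₂ refl | _ = trans (g-outside k (inj₁ ≤-refl))
                          (trans (sym (isStd I (<⇒≤ I<n))) (cong (λ z → std (drop z (f I))) (sym (n∸n≡0 I))))
  ... | inj₁ _ | inj₂ refl = trans (g-outside k (inj₂ ≤-refl))
                               (trans (sym (proj₂ (proj₂ (proj₂ (proj₁ exteriorF)))))
                                      (cong (λ z → std (drop z (f I))) d∸e≡))
    where
    d∸e≡ : d ∸ e ≡ J ∸ I
    d∸e≡ = trans (cong (_∸ e) d≡e+) (m+n∸m≡n e (J ∸ I))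
  ... | inj₁ I<k | inj₁ k<J = g-inside k I<k k<J

  -- Consecutive tails form covers, so g is again a maximal chain.
  g-cover : ∀ k → k < n → g (suc k) ⋖ g k
  g-cover k k<n = byCases (k <? I) (k <? J)
    where
    byCases : Dec (k < I) → Dec (k < J) → g (suc k) ⋖ g k
    byCases (yes k<I) _ = subst₂ _⋖_ (sym (g-outside (suc k) (inj₁ k<I)))
                                     (sym (g-outside k (inj₁ (<⇒≤ k<I)))) (cover k k<n)
    byCases (no k≮I) (no k≮J) = subst₂ _⋖_ (sym (g-outside (suc k) (inj₂ (≤-trans (≮⇒≥ k≮J) (n≤1+n k)))))
                                          (sym (g-outside k (inj₂ (≮⇒≥ k≮J)))) (cover k k<n)
    byCases (no k≮I) (yes k<J) = subst₂ _⋖_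
      (sym (trans (g-segment (suc k) (≤-trans I≤k (n≤1+n k)) k<J) (cong (λ z → std (drop z (f I))) (+-∸-assoc 1 I≤k))))
      (sym (g-segment k I≤k (<⇒≤ k<J)))
      (drop-cover (k ∸ I) (f I) room)
      where
      I≤k : I ≤ k
      I≤k = ≮⇒≥ k≮I
      room : suc (k ∸ I) ≤ d
      room = ≤-trans (subst (_≤ J ∸ I) (+-∸-assoc 1 I≤k) (∸-monoˡ-≤ I k<J))
                     (subst (J ∸ I ≤_) (sym d≡e+) (m≤n+m (J ∸ I) e))

  ρ' : Chain n
  ρ' k = g (toℕ k)

  at-ρ' : ∀ k → k ≤ n → at ρ' k ≡ g k
  at-ρ' k k≤n = cong g (toℕ-clamp n k k≤n)

  maximal' : IsMaximalChain σ τ ρ'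
  maximal' = trans (g-outside 0 (inj₁ z≤n)) f0 ,
             trans (cong g (toℕ-fromℕ n)) (trans (g-outside n (inj₂ J≤n)) fn) ,
             λ k → subst (λ z → g (suc (toℕ k)) ⋖ g z) (sym (toℕ-inject₁ k)) (g-cover (toℕ k) (toℕ<n k))

  label' : ℕ → ℕ
  label' = labelAt τ (1 , length τ) (at ρ')

  label'-before : ∀ m → m < I → label' m ≡ label m
  label'-before m m<I = labelAt-agree τ (1 , length τ) (at ρ') f m
    (λ m' m'≤ → trans (at-ρ' m' (≤-trans m'≤ (≤-trans m<I (<⇒≤ I<n)))) (g-outside m' (inj₁ (≤-trans m'≤ m<I))))

  -- At step I the earlier chain deletes the first letter of ρ_I.
  label'-at-I : label' I ≡ suc A
  label'-at-I = begin
    label' I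
      ≡⟨ labelAt-agree τ (1 , length τ) (at ρ') g I (λ m m≤ → at-ρ' m (≤-trans m≤ I<n)) ⟩
    proj₁ (labelStep τ (windowAt τ (1 , length τ) g I) (g I) (g (suc I)))
      ≡⟨ cong₂ (λ w x → proj₁ (labelStep τ w x (g (suc I))))
               (trans (windowAt-agree τ (1 , length τ) g f I (λ m m≤I → g-outside m (inj₁ m≤I)))
                      (proj₁ (located I (<⇒≤ I<n))))
               (g-outside I (inj₁ ≤-refl)) ⟩
    proj₁ (labelStep τ (windowOf A (f I)) (f I) (g (suc I)))
      ≡⟨ cong proj₁ (labelStep-tail τ (suc A) (A + d) {f I} tail-occurs) ⟩
    suc A ∎
    where
    open ≡-Reasoning
    L : ℕ
    L = length (f (suc I))
    d≡ : d ≡ suc L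
    d≡ = length-step I I<n
    tail-occurs : std (window τ (suc (suc A)) (A + d)) ≡ g (suc I)
    tail-occurs = begin
      std (window τ (suc (suc A)) (A + d)) ≡⟨ cong std (tail-window τ A (f I) L d≡) ⟩
      std (factor (suc A) L τ)             ≡⟨ sym (tail-occurrence τ A (f I) L occI d≡) ⟩
      std (factor 1 L (f I))               ≡⟨ cong std (take-all L (drop 1 (f I)) (≤-reflexive length-tail)) ⟩
      std (drop 1 (f I))                   ≡⟨ cong (λ z → std (drop z (f I))) (sym I+1∸I≡1) ⟩
      std (drop (suc I ∸ I) (f I))         ≡⟨ sym (g-inside (suc I) (n<1+n I) I+2≤J) ⟩
      g (suc I)                            ∎
      where
      length-tail : length (drop 1 (f I)) ≡ L
      length-tail = trans (length-drop 1 (f I)) (cong (_∸ 1) d≡)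
      I+1∸I≡1 : suc I ∸ I ≡ 1
      I+1∸I≡1 = trans (+-∸-assoc 1 (≤-refl {I})) (cong suc (n∸n≡0 I))

  -- ... while ρ deletes the last one, with the larger label A + d.
  earlier : chainId τ ρ' <lex chainId τ ρ
  earlier = subst₂ (Lex-< _≡_ _<_) (sym (labels≡labelAt n τ 1 (length τ) ρ')) (sym chainId≡)
    (lex-applyUpTo-intro n label' label I I<n label'-before
      (subst₂ _<_ (sym label'-at-I) (sym (proj₁ (drops-last-inside I ≤-refl I+2≤J))) (first<last I A I<n)))

  -- C(ρ_I, ρ_J) is nonempty (it contains ρ_{I+1}), and ρ' keeps every other member of ρ.
  skipped : IsSkipped σ τ ρ i j
  skipped = (f (suc I) , clamp n (suc I) , subst (I <_) (sym toℕk) (n<1+n I) , subst (_< J) (sym toℕk) I+2≤J , refl) ,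
            (ρ' , maximal' , earlier , kept)
    where
    toℕk : toℕ (clamp n (suc I)) ≡ suc I
    toℕk = toℕ-clamp n (suc I) I<n
    kept : ∀ (m : Fin (suc n)) → ¬ InC ρ i j (ρ m) → InChain ρ' (ρ m)
    kept m notIn with I <? toℕ m | toℕ m <? J
    ... | yes I<m | yes m<J = ⊥-elim (notIn (m , I<m , m<J , refl))
    ... | yes _   | no m≮J  = m , trans (g-outside (toℕ m) (inj₂ (≮⇒≥ m≮J))) (sym (ρ≡f m))
    ... | no I≮m  | _       = m , trans (g-outside (toℕ m) (inj₁ (≮⇒≥ I≮m))) (sym (ρ≡f m))

  occurs-at-A : ∀ k → I ≤ k → k < J → OccursAt τ A (f k)
  occurs-at-A k I≤k k<J = subst (λ B → OccursAt τ B (f k)) (offset-inside k I≤k k<J)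
                                (proj₂ (located k (<⇒≤ (<-≤-trans k<J J≤n))))

  -- Its earlier chain ρ'' first differs from ρ at some step p with I' ≤ p < J', deleting the
  -- first letter where ρ deletes the last; afterwards its occurrence of ρ_J' starts at some
  -- A'' > A and ends no later than ρ_I's does. If it ends strictly earlier, ρ_J (a prefix of
  -- ρ_J') lies in the interior of ρ_I; otherwise ρ_J' is a prefix and suffix of ρ_I longer
  -- than x(ρ_I).
  module Minimal (i' j' : Fin (suc n)) (i'<j' : toℕ i' < toℕ j') (skipped' : IsSkipped σ τ ρ i' j')
    (inner : ∀ π → InC ρ i' j' π → InC ρ i j π) (π : List ℕ) (π∈ : InC ρ i j π) (π∉ : ¬ InC ρ i' j' π) where

    I' J' : ℕ
    I' = toℕ i'
    J' = toℕ j'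

    J'≤n : J' ≤ n
    J'≤n = s≤s⁻¹ (toℕ<n j')

    inner-positions : ∀ k → I' < k → k < J' → (I < k) × (k < J)
    inner-positions k I'<k k<J' with inner (f k) (clamp n k , subst (I' <_) (sym toℕk) I'<k , subst (_< J') (sym toℕk) k<J' , refl)
      where
      toℕk : toℕ (clamp n k) ≡ k
      toℕk = toℕ-clamp n k (≤-trans (<⇒≤ k<J') J'≤n)
    ... | m , I<m , m<J , ρm≡ = subst (I <_) m≡k I<m , subst (_< J) m≡k m<J
      where
      m≡k : toℕ m ≡ k
      m≡k = position-of m k (≤-trans (<⇒≤ k<J') J'≤n) ρm≡

    I'+1<J' : suc I' < J'
    I'+1<J' with proj₂ (proj₁ skipped')
    ... | k , I'<k , k<J' , _ = <-≤-trans (s≤s I'<k) k<J'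

    I≤I' : I ≤ I'
    I≤I' = s≤s⁻¹ (proj₁ (inner-positions (suc I') (n<1+n I') I'+1<J'))

    J'≤J : J' ≤ J
    J'≤J = lastInside J' I'+1<J' ≤-refl
      where
      lastInside : ∀ m → suc I' < m → m ≤ J' → m ≤ J
      lastInside (suc m) I'+1<m m<J' = proj₂ (inner-positions m (s≤s⁻¹ I'+1<m) m<J')

    -- C(ρ_I', ρ_J') misses π, so the inner interval is a proper subinterval
    proper : J' ≡ J → I < I'
    proper J'≡J = witness π∈
      where
      witness : InC ρ i j π → I < I'
      witness (k , I<k , k<J , ρk≡π) with I' <? toℕ k
      ... | yes I'<k = ⊥-elim (π∉ (k , I'<k , subst (toℕ k <_) (sym J'≡J) k<J , ρk≡π))
      ... | no I'≮k = <-≤-trans I<k (≮⇒≥ I'≮k)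

    ρ'' : Chain n
    ρ'' = proj₁ (proj₂ skipped')

    maximal'' : IsMaximalChain σ τ ρ''
    maximal'' = proj₁ (proj₂ (proj₂ skipped'))

    open TwoChains σ τ permσ permτ (≼-length σ≼τ) ρ ρ'' maxρ maximal''
      using (module G; same-length; same-label; first-difference)

    agree : ∀ k → k ≤ n → (k ≤ I' ⊎ J' ≤ k) → G.f k ≡ f k
    agree k k≤n outside with proj₂ (proj₂ (proj₂ (proj₂ skipped'))) (clamp n k) notInner
      where
      notInner : ¬ InC ρ i' j' (f k)
      notInner (m , I'<m , m<J' , ρm≡) = excluded outside (position-of m k k≤n ρm≡)
        where
        excluded : (k ≤ I' ⊎ J' ≤ k) → toℕ m ≡ k → ⊥
        excluded (inj₁ k≤I') m≡k = <-irrefl refl (<-≤-trans (subst (I' <_) m≡k I'<m) k≤I')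
        excluded (inj₂ J'≤k) m≡k = <-irrefl refl (<-≤-trans (subst (_< J') m≡k m<J') J'≤k)
    ... | m , ρ''m≡ = subst (λ z → G.f z ≡ f k) m≡k Gfm≡
      where
      Gfm≡ : G.f (toℕ m) ≡ f k
      Gfm≡ = trans (sym (G.ρ≡f m)) ρ''m≡
      m≡k : toℕ m ≡ k
      m≡k = G.position-unique (toℕ m) k (s≤s⁻¹ (toℕ<n m)) k≤n (trans (cong length Gfm≡) (sym (same-length k k≤n)))

    difference : Σ ℕ λ p → (p < n) × (∀ m → m < p → G.label m ≡ label m) × (G.label p < label p)
    difference = lex-applyUpTo-elim n G.label label
      (subst₂ (Lex-< _≡_ _<_) G.chainId≡ chainId≡ (proj₁ (proj₂ (proj₂ (proj₂ skipped')))))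

    module AtDifference (p : ℕ) (p<n : p < n) (same-before : ∀ m → m < p → G.label m ≡ label m)
      (G<F : G.label p < label p) where

      -- outside C(ρ_I', ρ_J') both chains agree, so they cannot differ there
      labels-agree-at : (suc p ≤ I' ⊎ J' ≤ p) → G.label p ≡ label p
      labels-agree-at outside = same-label p p<n same-before (agree p (<⇒≤ p<n) (weaken outside))
                                           (agree (suc p) p<n (shift outside))
        where
        weaken : (suc p ≤ I' ⊎ J' ≤ p) → (p ≤ I' ⊎ J' ≤ p)
        weaken (inj₁ p<I') = inj₁ (<⇒≤ p<I')
        weaken (inj₂ J'≤p) = inj₂ J'≤p
        shift : (suc p ≤ I' ⊎ J' ≤ p) → (suc p ≤ I' ⊎ J' ≤ suc p)
        shift (inj₁ p<I') = inj₁ p<I'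
        shift (inj₂ J'≤p) = inj₂ (≤-trans J'≤p (n≤1+n p))

      I'≤p : I' ≤ p
      I'≤p with p <? I'
      ... | yes p<I' = ⊥-elim (<-irrefl (labels-agree-at (inj₁ p<I')) G<F)
      ... | no p≮I' = ≮⇒≥ p≮I'

      p<J' : p < J'
      p<J' with p <? J'
      ... | yes p<J' = p<J'
      ... | no p≮J' = ⊥-elim (<-irrefl (labels-agree-at (inj₂ (≮⇒≥ p≮J'))) G<F)

      I≤p : I ≤ p
      I≤p = ≤-trans I≤I' I'≤p

      p<J : p < J
      p<J = <-≤-trans p<J' J'≤J

      A'' L : ℕ
      A'' = G.offset J'
      L = length (f J')

      occJ' : OccursAt τ A'' (f J')
      occJ' = subst (OccursAt τ A'') (agree J' J'≤n (inj₂ ≤-refl)) (proj₂ (G.located J' J'≤n))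

      G-offset-after : G.offset (suc p) ≡ suc A
      G-offset-after = trans (proj₁ (first-difference p p<n same-before G<F))
                             (cong suc (offset-inside p I≤p p<J))

      A<A'' : A < A''
      A<A'' = subst (_≤ A'') G-offset-after (G.offset-mono (suc p) J' p<J' J'≤n)

      end-bound : A'' + L ≤ A + length (f p)
      end-bound = begin
        A'' + L                                   ≡⟨ cong (A'' +_) (cong length (sym (agree J' J'≤n (inj₂ ≤-refl)))) ⟩
        G.end J'                                  ≤⟨ G.end-antitone (suc p) J' p<J' J'≤n ⟩
        G.offset (suc p) + length (G.f (suc p))   ≡⟨ cong₂ _+_ G-offset-after (same-length (suc p) p<n) ⟩
        suc A + length (f (suc p))                ≡⟨ sym (+-suc A _) ⟩
        A + suc (length (f (suc p)))              ≡⟨ cong (A +_) (sym (length-step p p<n)) ⟩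
        A + length (f p)                          ∎
        where open ≤-Reasoning

      length-p≤d : length (f p) ≤ d
      length-p≤d = length-antitone I p I≤p (<⇒≤ p<n)

      -- ρ_J is the prefix of ρ_J' of length e: directly if J' = J, and otherwise
      -- because ρ_J' occurs at offset A too, so both are prefixes of ρ_I.
      e≤L : e ≤ L
      e≤L = length-antitone J' J J'≤J J≤n

      prefix-J' : prefix e (f J') ≡ f J
      prefix-J' = byCase (m≤n⇒m<n∨m≡n J'≤J)
        where
        open ≡-Reasoning
        byCase : (J' < J) ⊎ (J' ≡ J) → prefix e (f J') ≡ f J
        byCase (inj₂ J'≡J) = trans (cong (λ z → prefix e (f z)) J'≡J)
                                   (trans (cong std (take-all e (f J) ≤-refl)) (isStd J J≤n))
        byCase (inj₁ J'<J) = begin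
          prefix e (f J')          ≡⟨ occurrence-prefix τ A (occurs-at-A J' (≤-trans I≤I' (<⇒≤ i'<j')) J'<J) e e≤L ⟩
          std (factor A e τ)       ≡⟨ sym (occurrence-prefix τ A occI e (<⇒≤ (proj₁ (proj₂ (proj₁ exteriorF))))) ⟩
          prefix e (f I)           ≡⟨ proj₁ (proj₂ (proj₂ (proj₁ exteriorF))) ⟩
          f J                      ∎

      ends-earlier : A'' + L < A + d → ⊥
      ends-earlier lt = notInInteriorF (occurrence-interior τ occI occJ A<A'' (≤-<-trans (+-monoʳ-≤ A'' e≤L) lt))
        where
        occJ : OccursAt τ A'' (f J)
        occJ = trans (sym (occurrence-prefix τ A'' occJ' e e≤L)) prefix-J'

      -- If they end together, then p = I = I', so J' < J and ρ_J' is both a prefix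
      -- and a suffix of ρ_I, longer than its exterior.
      ends-together : A'' + L ≡ A + d → ⊥
      ends-together same-end = <-irrefl refl (<-≤-trans e<L (proj₂ exteriorF (f J') prefix-suffix))
        where
        p≡I : p ≡ I
        p≡I = position-unique p I (<⇒≤ p<n) (<⇒≤ I<n) (≤-antisym length-p≤d
                (+-cancelˡ-≤ A d (length (f p)) (subst (_≤ A + length (f p)) same-end end-bound)))
        J'<J : J' < J
        J'<J = byCase (m≤n⇒m<n∨m≡n J'≤J)
          where
          byCase : (J' < J) ⊎ (J' ≡ J) → J' < J
          byCase (inj₁ J'<J) = J'<J
          byCase (inj₂ J'≡J) = ⊥-elim (<-irrefl refl (<-≤-trans (proper J'≡J) (subst (I' ≤_) p≡I I'≤p)))
        I<J' : I < J'
        I<J' = ≤-<-trans I≤I' i'<j'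
        e<L : e < L
        e<L = shorter J' J J'<J J≤n
        L<d : L < d
        L<d = shorter I J' I<J' J'≤n
        start≡ : A + (d ∸ L) ≡ A''
        start≡ = trans (sym (+-∸-assoc A (<⇒≤ L<d))) (trans (cong (_∸ L) (sym same-end)) (m+n∸n≡m A'' L))
        prefix-suffix : IsProperPrefixSuffix (f I) (f J')
        prefix-suffix = <-≤-trans (proj₁ (proj₁ exteriorF)) e≤L , L<d ,
          trans (occurrence-prefix τ A occI L (<⇒≤ L<d)) (occurs-at-A J' (<⇒≤ I<J') J'<J) ,
          trans (occurrence-suffix τ A occI L (<⇒≤ L<d)) (trans (cong (λ z → std (factor z L τ)) start≡) occJ')

      contradiction : ⊥
      contradiction = byCase (m≤n⇒m<n∨m≡n (≤-trans end-bound (+-monoʳ-≤ A length-p≤d)))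
        where
        byCase : (A'' + L < A + d) ⊎ (A'' + L ≡ A + d) → ⊥
        byCase (inj₁ earlier-end) = ends-earlier earlier-end
        byCase (inj₂ same-end) = ends-together same-end

    contradiction : ⊥
    contradiction = AtDifference.contradiction (proj₁ difference) (proj₁ (proj₂ difference))
                      (proj₁ (proj₂ (proj₂ difference))) (proj₂ (proj₂ (proj₂ difference)))

  no-smaller-skipped : ∀ (i' j' : Fin (suc n)) → toℕ i' < toℕ j' → IsSkipped σ τ ρ i' j' →
    ¬ ((∀ π → InC ρ i' j' π → InC ρ i j π) × (∃[ π ] InC ρ i j π × ¬ InC ρ i' j' π))
  no-smaller-skipped i' j' i'<j' skipped' (inner , π , π∈ , π∉) =
    Minimal.contradiction i' j' i'<j' skipped' inner π π∈ π∉


proposition2p5 : (σ τ : List ℕ) → IsPerm σ → IsPerm τ → σ ≼ τ →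
    (ρ : Chain (length τ ∸ length σ)) → IsMaximalChain σ τ ρ →
    (i j : Fin (suc (length τ ∸ length σ))) → toℕ i < toℕ j →
    IsExterior (ρ i) (ρ j) → ¬ (ρ j ≼ interior (ρ i)) →
    DecreasingSegment (chainId τ ρ) (toℕ i) (toℕ j) →
    IsMinimalSkipped σ τ ρ i j
proposition2p5 σ τ permσ permτ σ≼τ ρ maxρ i j i<j exterior notInInterior decreasing =
  skipped , no-smaller-skipped
  where open Proposition σ τ permσ permτ σ≼τ ρ maxρ i j i<j exterior notInInterior decreasing
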